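{- (1) The category $\mathbf{SIF}_{\mathbf t}$ is a full reflective subcategory of $\mathbf{CIF}_{\mathbf t}$. (2) The categories $\mathbf{SIF}_{\mathbf t}$ and $\mathbf{CIF}_{\mathbf t}$ are equivalent.
   Context: A continuous information frame is a triple $\mathbb{A}=(A,(\mathrm{Con}_i)_{i\in A},(\vDash_i)_{i\in A})$ where $A$ is a set, each $\mathrm{Con}_i$ is a set of finite subsets of $A$, and $\vDash_i\subseteq\mathrm{Con}_i\times A$; write $iRj$ iff $\{i\}\in\mathrm{Con}_j$, and $X\vDash_i Y$ iff $X\vDash_i b$ for all $b\in Y$. Required, for all $i,j,a\in A$ and finite $X,Y\subseteq A$: (i) $\{i\}\in\mathrm{Con}_i$; (ii) if $Y\subseteq X\in\mathrm{Con}_i$ then $Y\in\mathrm{Con}_i$; (iii) if $X\in\mathrm{Con}_i$ and $X\vDash_i Y$ then $Y\in\mathrm{Con}_i$; (iv) if $X,Y\in\mathrm{Con}_i$, $X\subseteq Y$, $X\vDash_i a$ then $Y\vDash_i a$; (v) if $X\in\mathrm{Con}_i$, $X\vDash_i Y$, $Y\vDash_i a$ then $X\vDash_i a$; (vi) if $iRj$ then $\mathrm{Con}_i\subseteq\mathrm{Con}_j$; (vii) if $iRj$, $X\in\mathrm{Con}_i$, $X\vDash_i a$ then $X\vDash_j a$; (viii) if $X\vDash_i Y$ then there exist $e\in A$, $Z\in\mathrm{Con}_e$ with $X\vDash_i \{e\}\cup Z$ and $Z\vDash_e Y$. It is strong if for all $i$ and $X\in\mathrm{Con}_i$ with $X\neq\{i\}$,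 $\{i\}\vDash_i X$. A token $\mathbf t$ is a truth element if $\emptyset\vDash_i\mathbf t$ for all $i\in A$. An approximable family $\mathbb H=(H_i)_{i\in A}$ from $\mathbb A$ to $\mathbb A'$ is a family of relations $H_i\subseteq\mathrm{Con}_i\times A'$ (write $XH_iY$ iff $XH_ic$ for all $c\in Y$) such that for all $i,j\in A$, $X,X'\in\mathrm{Con}_i$, $b,k\in A'$, $Y\in\mathrm{Con}'_k$, finite $F\subseteq A'$: (a) $XH_i(\{k\}\cup Y)$ and $Y\vDash'_k b$ imply $XH_ib$; (b) $X\subseteq X'$ and $XH_ib$ imply $X'H_ib$; (c) $X\vDash_iX'$ and $X'H_ib$ imply $XH_ib$; (d) $iRj$ and $XH_ib$ imply $XH_jb$; (e) if $XH_iF$ there are $c\in A$, $e\in A'$, $U\in\mathrm{Con}_c$, $V\in\mathrm{Con}'_e$ with $X\vDash_i\{c\}\cup U$, $UH_c(\{e\}\cup V)$, $V\vDash'_eF$. If $\mathbb A,\mathbb A'$ have truth elements $\mathbf t,\mathbf t'$, $\mathbb H$ respects truth elements if $\emptyset H_{\mathbf t}\mathbf t'$. Composition of $\mathbb G:\mathbb A^{(1)}\to\mathbb A^{(2)}$ and $\mathbb H:\mathbb A^{(2)}\to\mathbb A^{(3)}$: $X(\mathbb G\circ\mathbb H)_ia$ iff there are $e\in A^{(2)}$, $V\in\mathrm{Con}^{(2)}_e$ with $XG_i(\{e\}\cup V)$ and $VH_ea$; identity is $(\vDash_i)_{i\in A}$. $\mathbf{CIF}_{\mathbf t}$ (resp.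 $\mathbf{SIF}_{\mathbf t}$) is the category of continuous (resp. strong continuous) information frames with truth elements and truth-element-respecting approximable families. -}

module Defs where

open import Data.List using (List; []; _∷_; [_])
open import Data.List.Relation.Binary.Subset.Propositional using (_⊆_)
open import Data.List.Relation.Unary.All using (All)
open import Data.Product using (Σ; _×_; _,_; proj₁; proj₂)
open import Relation.Nullary using (¬_)

-- Finite subsets of A are represented by lists; "Y ⊆ X" is inclusion of
-- elements, {e} ∪ Z is e ∷ Z, {i} is [ i ].
-- Ent i X a  means  X ⊨_i a  (the relation ⊨_i ⊆ Con_i × A).

record CIF : Set₁ where
  field
    Tok : Set
    Con : Tok → List Tok → Set
    Ent : Tok → List Tok → Tok → Set
    Ent⇒Con : ∀ {i X a} → Ent i X a → Con i X

  R : Tok → Tok → Set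
  R i j = Con j [ i ]

  Ents : Tok → List Tok → List Tok → Set
  Ents i X Y = All (Ent i X) Y

  field
    ax-i    : ∀ i → Con i [ i ]
    ax-ii   : ∀ {i X Y} → Y ⊆ X → Con i X → Con i Y
    ax-iii  : ∀ {i X Y} → Con i X → Ents i X Y → Con i Y
    ax-iv   : ∀ {i X Y a} → Con i X → Con i Y → X ⊆ Y → Ent i X a → Ent i Y a
    ax-v    : ∀ {i X Y a} → Con i X → Ents i X Y → Ent i Y a → Ent i X a
    ax-vi   : ∀ {i j X} → R i j → Con i X → Con j X
    ax-vii  : ∀ {i j X a} → R i j → Con i X → Ent i X a → Ent j X a
    ax-viii : ∀ {i X Y} → Con i X → Ents i X Y →
              Σ Tok λ e → Σ (List Tok) λ Z →
                Con e Z × Ents i X (e ∷ Z) × Ents e Z Y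

open CIF

IsStrong : CIF → Set
IsStrong 𝔸 = ∀ i X → Con 𝔸 i X → ¬ (X ⊆ [ i ] × [ i ] ⊆ X) → Ents 𝔸 i [ i ] X

IsTruth : (𝔸 : CIF) → Tok 𝔸 → Set
IsTruth 𝔸 t = ∀ i → Ent 𝔸 i [] t

record CIFt : Set₁ where
  field
    frame : CIF
    t     : Tok frame
    truth : IsTruth frame t

open CIFt

-- Raw families of relations H_i ⊆ Con_i × A'  (H i X b  means  X H_i b)

Fam : CIF → CIF → Set₁
Fam 𝔸 𝔸' = Tok 𝔸 → List (Tok 𝔸) → Tok 𝔸' → Set

_≈F_ : ∀ {𝔸 𝔸'} → Fam 𝔸 𝔸' → Fam 𝔸 𝔸' → Set
_≈F_ {𝔸} {𝔸'} H K =
  ∀ (i : Tok 𝔸) (X : List (Tok 𝔸)) (b : Tok 𝔸') → (H i X b → K i X b) × (K i X b → H i X b)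

-- composition (diagrammatic: G ⨾ H is the paper's G ∘ H, first G then H)
_⨾F_ : ∀ {𝔸₁ 𝔸₂ 𝔸₃} → Fam 𝔸₁ 𝔸₂ → Fam 𝔸₂ 𝔸₃ → Fam 𝔸₁ 𝔸₃
_⨾F_ {𝔸₁} {𝔸₂} G H i X a =
  Σ (Tok 𝔸₂) λ e → Σ (List (Tok 𝔸₂)) λ V →
    Con 𝔸₂ e V × All (G i X) (e ∷ V) × H e V a

idF : ∀ 𝔸 → Fam 𝔸 𝔸
idF 𝔸 = Ent 𝔸

record IsApprox (𝔸 𝔸' : CIF) (H : Fam 𝔸 𝔸') : Set where
  field
    H⇒Con : ∀ {i X b} → H i X b → Con 𝔸 i X
    ax-a  : ∀ {i X k Y b} → Con 𝔸 i X → Con 𝔸' k Y →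
            All (H i X) (k ∷ Y) → Ent 𝔸' k Y b → H i X b
    ax-b  : ∀ {i X X' b} → Con 𝔸 i X → Con 𝔸 i X' →
            X ⊆ X' → H i X b → H i X' b
    ax-c  : ∀ {i X X' b} → Con 𝔸 i X → Con 𝔸 i X' →
            Ents 𝔸 i X X' → H i X' b → H i X b
    ax-d  : ∀ {i j X b} → Con 𝔸 i X → R 𝔸 i j → H i X b → H j X b
    ax-e  : ∀ {i X F} → Con 𝔸 i X → All (H i X) F →
            Σ (Tok 𝔸) λ c → Σ (Tok 𝔸') λ e →
            Σ (List (Tok 𝔸)) λ U → Σ (List (Tok 𝔸')) λ V →
              Con 𝔸 c U × Con 𝔸' e V × Ents 𝔸 i X (c ∷ U) ×
              All (H c U) (e ∷ V) × Ents 𝔸' e V F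

record Hom (𝔸 𝔸' : CIFt) : Set₁ where
  field
    fam    : Fam (frame 𝔸) (frame 𝔸')
    approx : IsApprox (frame 𝔸) (frame 𝔸') fam
    resp   : fam (t 𝔸) [] (t 𝔸')

-- Morphisms are given together with an
-- underlying "raw" representation on which identity, composition and
-- equality of morphisms are defined (so no closure proofs are needed to
-- state the universal properties; composites are compared via ≈).

record RawCat : Set₂ where
  field
    Obj  : Set₁
    Mor  : Obj → Obj → Set₁
    Raw  : Obj → Obj → Set₁
    ⌊_⌋  : ∀ {a b} → Mor a b → Raw a b
    _≈_  : ∀ {a b} → Raw a b → Raw a b → Set
    _⨾_  : ∀ {a b c} → Raw a b → Raw b c → Raw a c
    idR  : ∀ a → Raw a a

CIFtCat : RawCat
CIFtCat = record
  { Obj = CIFt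
  ; Mor = Hom
  ; Raw = λ 𝔸 𝔸' → Fam (frame 𝔸) (frame 𝔸')
  ; ⌊_⌋ = Hom.fam
  ; _≈_ = λ {𝔸} {𝔸'} H K → _≈F_ {frame 𝔸} {frame 𝔸'} H K
  ; _⨾_ = λ {𝔸₁} {𝔸₂} {𝔸₃} G H → _⨾F_ {frame 𝔸₁} {frame 𝔸₂} {frame 𝔸₃} G H
  ; idR = λ 𝔸 → idF (frame 𝔸)
  }

FullSub : (C : RawCat) → (RawCat.Obj C → Set) → RawCat
FullSub C P = record
  { Obj = Σ Obj P
  ; Mor = λ a b → Mor (proj₁ a) (proj₁ b)
  ; Raw = λ a b → Raw (proj₁ a) (proj₁ b)
  ; ⌊_⌋ = ⌊_⌋
  ; _≈_ = _≈_
  ; _⨾_ = _⨾_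
  ; idR = λ a → idR (proj₁ a)
  }
  where open RawCat C

SIFtCat : RawCat
SIFtCat = FullSub CIFtCat (λ 𝔸 → IsStrong (frame 𝔸))

IsReflective : (C : RawCat) → (RawCat.Obj C → Set) → Set₁
IsReflective C P =
  ∀ a → Σ Obj λ r → P r × Σ (Mor a r) λ η →
    ∀ b → P b → (f : Mor a b) →
      Σ (Mor r b) λ g → ((⌊ η ⌋ ⨾ ⌊ g ⌋) ≈ ⌊ f ⌋) ×
        (∀ (g' : Mor r b) → (⌊ η ⌋ ⨾ ⌊ g' ⌋) ≈ ⌊ f ⌋ → ⌊ g' ⌋ ≈ ⌊ g ⌋)
  where open RawCat C

record Functor (C D : RawCat) : Set₂ where
  private
    module C = RawCat C
    module D = RawCat D
  field
    F₀     : C.Obj → D.Obj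
    F₁     : ∀ {a b} → C.Mor a b → D.Mor (F₀ a) (F₀ b)
    F-resp : ∀ {a b} (f g : C.Mor a b) → C.⌊ f ⌋ C.≈ C.⌊ g ⌋ →
             D.⌊ F₁ f ⌋ D.≈ D.⌊ F₁ g ⌋
    F-id   : ∀ {a} (k : C.Mor a a) → C.⌊ k ⌋ C.≈ C.idR a →
             D.⌊ F₁ k ⌋ D.≈ D.idR (F₀ a)
    F-comp : ∀ {a b c} (f : C.Mor a b) (g : C.Mor b c) (k : C.Mor a c) →
             C.⌊ k ⌋ C.≈ (C.⌊ f ⌋ C.⨾ C.⌊ g ⌋) →
             D.⌊ F₁ k ⌋ D.≈ (D.⌊ F₁ f ⌋ D.⨾ D.⌊ F₁ g ⌋)

record Equivalence (C D : RawCat) : Set₂ where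
  private
    module C = RawCat C
    module D = RawCat D
  field
    F : Functor C D
    G : Functor D C
  private
    module F = Functor F
    module G = Functor G
  field
    η     : ∀ a → C.Mor a (G.F₀ (F.F₀ a))
    η⁻¹   : ∀ a → C.Mor (G.F₀ (F.F₀ a)) a
    η-iso₁ : ∀ a → (C.⌊ η a ⌋ C.⨾ C.⌊ η⁻¹ a ⌋) C.≈ C.idR a
    η-iso₂ : ∀ a → (C.⌊ η⁻¹ a ⌋ C.⨾ C.⌊ η a ⌋) C.≈ C.idR (G.F₀ (F.F₀ a))
    η-nat : ∀ {a b} (f : C.Mor a b) →
            (C.⌊ f ⌋ C.⨾ C.⌊ η b ⌋) C.≈ (C.⌊ η a ⌋ C.⨾ C.⌊ G.F₁ (F.F₁ f) ⌋)
    ε     : ∀ d → D.Mor (F.F₀ (G.F₀ d)) d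
    ε⁻¹   : ∀ d → D.Mor d (F.F₀ (G.F₀ d))
    ε-iso₁ : ∀ d → (D.⌊ ε d ⌋ D.⨾ D.⌊ ε⁻¹ d ⌋) D.≈ D.idR (F.F₀ (G.F₀ d))
    ε-iso₂ : ∀ d → (D.⌊ ε⁻¹ d ⌋ D.⨾ D.⌊ ε d ⌋) D.≈ D.idR d
    ε-nat : ∀ {d e} (f : D.Mor d e) →
            (D.⌊ F.F₁ (G.F₁ f) ⌋ D.⨾ D.⌊ ε e ⌋) D.≈ (D.⌊ ε d ⌋ D.⨾ D.⌊ f ⌋)

module Submission where

-- A frame 𝔸 is isomorphic in CIF_t to a strong frame S 𝔸. The tokens of S 𝔸 are the pairs
-- p = (i, X) with X ∈ Con_i; writing p ⊳ (j, Z) for X ⊨_i {j} ∪ Z, a set Y is consistent at p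
-- if Y ⊆ {p} or p ⊳ q for all q ∈ Y, and Y ⊨_p q means that moreover p ⊳ q. Every consistent
-- Y other than {p} then satisfies {p} ⊨_p Y, so S 𝔸 is strong.
--
-- Families lift along S: X (liftCod f)_i (j, Z) iff X f_i {j} ∪ Z, and Y (liftDom f)_(i,X) c
-- iff Y is consistent at (i, X) and X f_i c. Composites of lifted families collapse, e.g.
-- liftCod f ⨾ liftDom g = f ⨾ g, so toS = liftCod (⊨) and fromS = liftDom (⊨) are mutually
-- inverse as soon as ⊨ is a two-sided unit for ⨾, which is what the interpolation axioms
-- give. Moreover a family g out of S 𝔸 is recovered from toS ⨾ g as liftDom (toS ⨾ g), which
-- makes toS a reflection. As every object is isomorphic to a strong one, the inclusion of
-- SIF_t is an equivalence with inverse S.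

open import Defs
open import Level using (0ℓ) renaming (suc to lsuc)
open import Data.Empty using (⊥-elim)
open import Data.List using (List; []; _∷_; [_]; map)
open import Data.List.Relation.Binary.Subset.Propositional using (_⊆_)
open import Data.List.Relation.Binary.Subset.Propositional.Properties using (⊆-refl; ⊆-trans)
open import Data.List.Relation.Unary.All as All using (All; []; _∷_)
open import Data.List.Relation.Unary.All.Properties
  using (++⁺; ++⁻ˡ; ++⁻ʳ; anti-mono; concat⁺; concat⁻; map⁺; map⁻)
open import Data.List.Relation.Unary.Any using (here)
open import Data.List.Relation.Unary.Any.Properties using (singleton⁻)
open import Data.Product using (Σ; _×_; _,_; proj₁; proj₂; swap; map₂)
open import Data.Sum using (_⊎_; inj₁; inj₂)
open import Function using (id; _∘_)
open import Relation.Binary.Bundles using (Setoid)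
open import Relation.Binary.PropositionalEquality using (_≡_; refl)
import Relation.Binary.Reasoning.Setoid as SetoidReasoning

open CIFt using (frame)

module _ {𝔸 𝔹 : CIF} {f : Fam 𝔸 𝔹} (ap : IsApprox 𝔸 𝔹 f) where
  private
    module A = CIF 𝔸
    module B = CIF 𝔹
  open IsApprox ap

  cut : ∀ {i X e V b} → A.Con i X → A.Ents i X (e ∷ V) → f e V b → f i X b
  cut cX (X⊨e ∷ X⊨V) fb = ax-c cX (A.ax-vi eRi (H⇒Con fb)) X⊨V (ax-d (H⇒Con fb) eRi fb)
    where eRi = A.ax-iii cX (X⊨e ∷ [])

  cut-All : ∀ {i X e V L} → A.Con i X → A.Ents i X (e ∷ V) → All (f e V) L → All (f i X) L
  cut-All cX X⊨eV = All.map (cut cX X⊨eV)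

  interpolate-dom : ∀ {i X F} → A.Con i X → All (f i X) F →
    Σ A.Tok λ c → Σ (List A.Tok) λ U → A.Con c U × A.Ents i X (c ∷ U) × All (f c U) F
  interpolate-dom cX fF with ax-e cX fF
  ... | c , e , U , V , cU , cV , X⊨cU , fV , V⊨F = c , U , cU , X⊨cU , All.map (ax-a cU cV fV) V⊨F

  interpolate-cod : ∀ {i X F} → A.Con i X → All (f i X) F →
    Σ B.Tok λ e → Σ (List B.Tok) λ V → B.Con e V × All (f i X) (e ∷ V) × B.Ents e V F
  interpolate-cod cX fF with ax-e cX fF
  ... | c , e , U , V , cU , cV , X⊨cU , fV , V⊨F = e , V , cV , cut-All cX X⊨cU fV , V⊨F

  amalgamate : ∀ {i X e₁ V₁ e₂ V₂} → A.Con i X → All (f i X) (e₁ ∷ V₁) → All (f i X) (e₂ ∷ V₂) →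
    Σ B.Tok λ e → Σ (List B.Tok) λ V → B.Con e V × All (f i X) (e ∷ V) ×
      B.Ents e V (e₁ ∷ V₁) × B.Ents e V (e₂ ∷ V₂)
  amalgamate {e₁ = e₁} {V₁} cX f₁ f₂ with interpolate-cod cX (++⁺ f₁ f₂)
  ... | e , V , cV , fV , V⊨ = e , V , cV , fV , ++⁻ˡ (e₁ ∷ V₁) V⊨ , ++⁻ʳ (e₁ ∷ V₁) V⊨

Con-[] : (𝔸 : CIF) → ∀ i → CIF.Con 𝔸 i []
Con-[] 𝔸 i = CIF.ax-ii 𝔸 (λ ()) (CIF.ax-i 𝔸 i)

id-approx : (𝔸 : CIF) → IsApprox 𝔸 𝔸 (CIF.Ent 𝔸)
id-approx 𝔸 = record
  { H⇒Con = Ent⇒Con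
  ; ax-a  = λ { cX cY (X⊨k ∷ X⊨Y) Y⊨b → ax-v cX X⊨Y (ax-vii (ax-iii cX (X⊨k ∷ [])) cY Y⊨b) }
  ; ax-b  = ax-iv
  ; ax-c  = λ cX _ → ax-v cX
  ; ax-d  = λ cX iRj → ax-vii iRj cX
  ; ax-e  = interpolate-twice
  }
  where
  open CIF 𝔸
  interpolate-twice : ∀ {i X F} → Con i X → Ents i X F →
    Σ Tok λ c → Σ Tok λ e → Σ (List Tok) λ U → Σ (List Tok) λ V →
      Con c U × Con e V × Ents i X (c ∷ U) × Ents c U (e ∷ V) × Ents e V F
  interpolate-twice cX X⊨F with ax-viii cX X⊨F
  ... | c , U , cU , X⊨cU , U⊨F with ax-viii cU U⊨F
  ... | e , V , cV , U⊨eV , V⊨F = c , e , U , V , cU , cV , X⊨cU , U⊨eV , V⊨F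

-- Fam 𝔸 𝔹 and _≈F_ unfold to function types from which Agda cannot recover the frames;
-- the records _⇸_ and _≃_ make them inferable.
record _⇸_ (𝔸 𝔹 : CIF) : Set₁ where
  constructor wrap
  field rel : Fam 𝔸 𝔹
open _⇸_

infix 4 _≃_
record _≃_ {𝔸 𝔹 : CIF} (f g : 𝔸 ⇸ 𝔹) : Set where
  constructor from-≈F
  field to-≈F : _≈F_ {𝔸} {𝔹} (rel f) (rel g)
open _≃_

infixl 5 _⨾_
_⨾_ : ∀ {𝔸 𝔹 ℂ} → 𝔸 ⇸ 𝔹 → 𝔹 ⇸ ℂ → 𝔸 ⇸ ℂ
_⨾_ {𝔸} {𝔹} {ℂ} f g = wrap (_⨾F_ {𝔸} {𝔹} {ℂ} (rel f) (rel g))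

idᶠ : (𝔸 : CIF) → 𝔸 ⇸ 𝔸
idᶠ 𝔸 = wrap (CIF.Ent 𝔸)

≃-setoid : CIF → CIF → Setoid (lsuc 0ℓ) 0ℓ
≃-setoid 𝔸 𝔹 = record
  { Carrier       = 𝔸 ⇸ 𝔹
  ; _≈_           = _≃_
  ; isEquivalence = record
    { refl  = from-≈F λ _ _ _ → id , id
    ; sym   = λ f≃g → from-≈F λ i X b → swap (to-≈F f≃g i X b)
    ; trans = λ f≃g g≃h → from-≈F λ i X b →
        proj₁ (to-≈F g≃h i X b) ∘ proj₁ (to-≈F f≃g i X b) ,
        proj₂ (to-≈F f≃g i X b) ∘ proj₂ (to-≈F g≃h i X b)
    }
  }

module ≃-Reasoning {𝔸 𝔹 : CIF} = SetoidReasoning (≃-setoid 𝔸 𝔹)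

module _ {𝔸 𝔹 : CIF} {f : 𝔸 ⇸ 𝔹} (ap : IsApprox 𝔸 𝔹 (rel f)) where
  open IsApprox ap

  ⨾-identityˡ : idᶠ 𝔸 ⨾ f ≃ f
  ⨾-identityˡ = from-≈F λ i X b →
    (λ { (_ , _ , _ , X⊨eV@(X⊨e ∷ _) , fb) → cut ap (CIF.Ent⇒Con 𝔸 X⊨e) X⊨eV fb }) ,
    λ fb → let c , U , cU , X⊨cU , fU = interpolate-dom ap (H⇒Con fb) (fb ∷ [])
           in c , U , cU , X⊨cU , All.head fU

  ⨾-identityʳ : f ⨾ idᶠ 𝔹 ≃ f
  ⨾-identityʳ = from-≈F λ i X b →
    (λ { (_ , _ , cV , fs@(fe ∷ _) , V⊨b) → ax-a (H⇒Con fe) cV fs V⊨b }) ,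
    λ fb → let e , V , cV , fs , V⊨b = interpolate-cod ap (H⇒Con fb) (fb ∷ [])
           in e , V , cV , fs , All.head V⊨b

module _ {𝔸 𝔹 ℂ : CIF} {f : 𝔸 ⇸ 𝔹} {g : 𝔹 ⇸ ℂ}
         (apf : IsApprox 𝔸 𝔹 (rel f)) (apg : IsApprox 𝔹 ℂ (rel g)) where
  private
    module A = CIF 𝔸
    module B = CIF 𝔹

  common-interpolant : ∀ {i X} → A.Con i X → (L : List (CIF.Tok ℂ)) → All (rel (f ⨾ g) i X) L →
    Σ B.Tok λ e → Σ (List B.Tok) λ V → B.Con e V × All (rel f i X) (e ∷ V) × All (rel g e V) L
  common-interpolant cX [] [] =
    let e , V , cV , fs , _ = interpolate-cod apf cX [] in e , V , cV , fs , []
  common-interpolant cX (_ ∷ L) ((_ , _ , _ , f₁ , g₁) ∷ fgL)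
    with common-interpolant cX L fgL
  ... | _ , _ , _ , f₂ , g₂ with amalgamate apf cX f₁ f₂
  ... | e , V , cV , fs , V⊨₁ , V⊨₂ = e , V , cV , fs , cut apg cV V⊨₁ g₁ ∷ cut-All apg cV V⊨₂ g₂

module StrongFrame (𝔸 : CIF) where
  open CIF 𝔸

  record Pair : Set where
    constructor pair
    field
      tok : Tok
      set : List Tok
      con : Con tok set
  open Pair public

  whole : Pair → List Tok
  whole p = tok p ∷ set p

  infix 4 _⊳_
  _⊳_ : Pair → Pair → Set
  p ⊳ q = Ents (tok p) (set p) (whole q)

  SCon : Pair → List Pair → Set
  SCon p Y = Y ⊆ [ p ] ⊎ All (p ⊳_) Y

  SEnt : Pair → List Pair → Pair → Set
  SEnt p Y q = SCon p Y × p ⊳ q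

  SCon-[_] : ∀ p → SCon p [ p ]
  SCon-[ p ] = inj₁ ⊆-refl

  ⊳-SCon : ∀ {p q Y} → q ⊳ p → SCon p Y → SCon q Y
  ⊳-SCon q⊳p (inj₁ Y⊆p) = inj₂ (anti-mono Y⊆p (q⊳p ∷ []))
  ⊳-SCon {q = q} q⊳p (inj₂ p⊳Y) = inj₂ (All.map (cut-All (id-approx 𝔸) (con q) q⊳p) p⊳Y)

  R-cases : ∀ {p q} → SCon q [ p ] → p ≡ q ⊎ q ⊳ p
  R-cases (inj₁ p∈q) = inj₁ (singleton⁻ (p∈q (here refl)))
  R-cases (inj₂ (q⊳p ∷ [])) = inj₂ q⊳p

  R-SCon : ∀ {p q Y} → SCon q [ p ] → SCon p Y → SCon q Y
  R-SCon qRp cY with R-cases qRp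
  ... | inj₁ refl = cY
  ... | inj₂ q⊳p = ⊳-SCon q⊳p cY

  R-transport : ∀ {ℂ} {g : Fam 𝔸 ℂ} → IsApprox 𝔸 ℂ g →
    ∀ {p q c} → SCon q [ p ] → g (tok p) (set p) c → g (tok q) (set q) c
  R-transport ap {q = q} qRp gc with R-cases qRp
  ... | inj₁ refl = gc
  ... | inj₂ q⊳p = cut ap (con q) q⊳p gc

  interpolate : ∀ {p Y Y′} → SCon p Y → All (SEnt p Y) Y′ →
    Σ Pair λ e → Σ (List Pair) λ Z → SCon e Z × All (SEnt p Y) (e ∷ Z) × All (SEnt e Z) Y′
  interpolate {p} {Y′ = Y′} cY Y⊨Y′ with ax-viii (con p) (concat⁺ (map⁺ (All.map proj₂ Y⊨Y′)))
  ... | e , Z , cZ , X⊨eZ , Z⊨Y′ =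
    pair e Z cZ , [] , inj₂ [] , (cY , X⊨eZ) ∷ [] ,
    All.map (inj₂ [] ,_) (map⁻ (concat⁻ {xss = map whole Y′} Z⊨Y′))

  S : CIF
  S = record
    { Tok     = Pair
    ; Con     = SCon
    ; Ent     = SEnt
    ; Ent⇒Con = proj₁
    ; ax-i    = SCon-[_]
    ; ax-ii   = λ { Y⊆X (inj₁ X⊆p) → inj₁ (⊆-trans Y⊆X X⊆p)
                  ; Y⊆X (inj₂ p⊳X) → inj₂ (anti-mono Y⊆X p⊳X) }
    ; ax-iii  = λ _ X⊨Y → inj₂ (All.map proj₂ X⊨Y)
    ; ax-iv   = λ _ cY _ (_ , p⊳a) → cY , p⊳a
    ; ax-v    = λ cX _ (_ , p⊳a) → cX , p⊳a
    ; ax-vi   = R-SCon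
    ; ax-vii  = λ qRp cX (_ , p⊳a) → R-SCon qRp cX , All.map (R-transport (id-approx 𝔸) qRp) p⊳a
    ; ax-viii = interpolate
    }

  S-strong : IsStrong S
  S-strong p [] _ _ = []
  S-strong p (q ∷ Y) (inj₁ qY⊆p) qY≉p with singleton⁻ (qY⊆p (here refl))
  ... | refl = ⊥-elim (qY≉p (qY⊆p , λ { (here refl) → here refl }))
  S-strong p Y (inj₂ p⊳Y) _ = All.map (SCon-[ p ] ,_) p⊳Y

  S-truth : ∀ {t} → IsTruth 𝔸 t → IsTruth S (pair t [] (Con-[] 𝔸 t))
  S-truth truth p = inj₂ [] , ax-iv (Con-[] 𝔸 (tok p)) (con p) (λ ()) (truth (tok p)) ∷ []

open StrongFrame using (S; S-strong; S-truth; pair)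

module _ {𝔸 𝔹 : CIF} where
  private
    module A = CIF 𝔸
    module B = CIF 𝔹
    module SA = StrongFrame 𝔸
    module SB = StrongFrame 𝔹

  liftCod : 𝔸 ⇸ 𝔹 → 𝔸 ⇸ S 𝔹
  liftCod f = wrap λ i X q → All (rel f i X) (SB.whole q)

  liftDom : 𝔸 ⇸ 𝔹 → S 𝔸 ⇸ 𝔹
  liftDom f = wrap λ p Y c → SA.SCon p Y × rel f (SA.tok p) (SA.set p) c

  liftCod-cong : {f g : 𝔸 ⇸ 𝔹} → f ≃ g → liftCod f ≃ liftCod g
  liftCod-cong f≃g = from-≈F λ i X q →
    All.map (proj₁ (to-≈F f≃g i X _)) , All.map (proj₂ (to-≈F f≃g i X _))

  liftDom-cong : {f g : 𝔸 ⇸ 𝔹} → f ≃ g → liftDom f ≃ liftDom g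
  liftDom-cong f≃g = from-≈F λ p Y c →
    map₂ (proj₁ (to-≈F f≃g _ _ c)) , map₂ (proj₂ (to-≈F f≃g _ _ c))

  module _ {f : 𝔸 ⇸ 𝔹} (ap : IsApprox 𝔸 𝔹 (rel f)) where
    open IsApprox ap

    liftCod-approx : IsApprox 𝔸 (S 𝔹) (rel (liftCod f))
    liftCod-approx = record
      { H⇒Con = λ { (fi ∷ _) → H⇒Con fi }
      ; ax-a  = λ { {k = k} cX _ (fk ∷ _) (_ , k⊳b) → All.map (ax-a cX (SB.con k) fk) k⊳b }
      ; ax-b  = λ cX cX′ X⊆X′ → All.map (ax-b cX cX′ X⊆X′)
      ; ax-c  = λ cX cX′ X⊨X′ → All.map (ax-c cX cX′ X⊨X′)
      ; ax-d  = λ cX iRj → All.map (ax-d cX iRj)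
      ; ax-e  = interpolate-through-pair
      }
      where
      interpolate-through-pair : ∀ {i X F} → A.Con i X → All (rel (liftCod f) i X) F →
        Σ A.Tok λ c → Σ SB.Pair λ e → Σ (List A.Tok) λ U → Σ (List SB.Pair) λ V →
          A.Con c U × SB.SCon e V × A.Ents i X (c ∷ U) ×
          All (rel (liftCod f) c U) (e ∷ V) × All (SB.SEnt e V) F
      interpolate-through-pair {F = F} cX fF with ax-e cX (concat⁺ (map⁺ fF))
      ... | c , e , U , V , cU , cV , X⊨cU , fV , V⊨F =
        c , SB.pair e V cV , U , [] , cU , inj₂ [] , X⊨cU , fV ∷ [] ,
        All.map (inj₂ [] ,_) (map⁻ (concat⁻ {xss = map SB.whole F} V⊨F))

    liftDom-approx : IsApprox (S 𝔸) 𝔹 (rel (liftDom f))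
    liftDom-approx = record
      { H⇒Con = proj₁
      ; ax-a  = λ { {i = p} cY cW ((_ , fk) ∷ fW) W⊨b →
                    cY , ax-a (SA.con p) cW (fk ∷ All.map proj₂ fW) W⊨b }
      ; ax-b  = λ _ cY′ _ (_ , fb) → cY′ , fb
      ; ax-c  = λ cY _ _ (_ , fb) → cY , fb
      ; ax-d  = λ cY qRp (_ , fb) → SA.R-SCon qRp cY , SA.R-transport ap qRp fb
      ; ax-e  = interpolate-through-pair
      }
      where
      interpolate-through-pair : ∀ {p Y F} → SA.SCon p Y → All (rel (liftDom f) p Y) F →
        Σ SA.Pair λ c → Σ B.Tok λ e → Σ (List SA.Pair) λ U → Σ (List B.Tok) λ V →
          SA.SCon c U × B.Con e V × All (SA.SEnt p Y) (c ∷ U) ×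
          All (rel (liftDom f) c U) (e ∷ V) × B.Ents e V F
      interpolate-through-pair {p} cY fF with ax-e (SA.con p) (All.map proj₂ fF)
      ... | c , e , U , V , cU , cV , X⊨cU , fV , V⊨F =
        SA.pair c U cU , e , [] , V , inj₂ [] , cV , (cY , X⊨cU) ∷ [] ,
        All.map (inj₂ [] ,_) fV , V⊨F

module _ {𝔸 𝔹 ℂ : CIF} where
  private module SB = StrongFrame 𝔹

  liftCod-⨾-liftDom : (f : 𝔸 ⇸ 𝔹) (g : 𝔹 ⇸ ℂ) → liftCod f ⨾ liftDom g ≃ f ⨾ g
  liftCod-⨾-liftDom f g = from-≈F λ i X c →
    (λ { (q , _ , _ , fq ∷ _ , _ , gc) → SB.tok q , SB.set q , SB.con q , fq , gc }) ,
    λ (e , V , cV , fs , gc) → SB.pair e V cV , [] , inj₂ [] , fs ∷ [] , inj₂ [] , gc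

  liftDom-⨾ : (f : 𝔸 ⇸ 𝔹) (g : 𝔹 ⇸ ℂ) → liftDom f ⨾ g ≃ liftDom (f ⨾ g)
  liftDom-⨾ f g = from-≈F λ p Y c →
    (λ { (e , V , cV , (cY , fe) ∷ fV , gc) → cY , e , V , cV , fe ∷ All.map proj₂ fV , gc }) ,
    λ (cY , e , V , cV , fs , gc) → e , V , cV , All.map (cY ,_) fs , gc

  ⨾-liftCod : {f : 𝔸 ⇸ 𝔹} {g : 𝔹 ⇸ ℂ} → IsApprox 𝔸 𝔹 (rel f) → IsApprox 𝔹 ℂ (rel g) →
    f ⨾ liftCod g ≃ liftCod (f ⨾ g)
  ⨾-liftCod apf apg = from-≈F λ i X q →
    (λ (e , V , cV , fs , gq) → All.map (λ gc → e , V , cV , fs , gc) gq) ,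
    λ { fgq@((_ , _ , _ , fe ∷ _ , _) ∷ _) →
          common-interpolant apf apg (IsApprox.H⇒Con apf fe) _ fgq }

module _ {𝔸 𝔹 : CIF} {f : 𝔸 ⇸ 𝔹} (ap : IsApprox 𝔸 𝔹 (rel f)) where
  open ≃-Reasoning

  liftCod-id-⨾-liftDom : liftCod (idᶠ 𝔸) ⨾ liftDom f ≃ f
  liftCod-id-⨾-liftDom = begin
    liftCod (idᶠ 𝔸) ⨾ liftDom f  ≈⟨ liftCod-⨾-liftDom _ _ ⟩
    idᶠ 𝔸 ⨾ f                    ≈⟨ ⨾-identityˡ ap ⟩
    f                             ∎

  liftDom-id-⨾ : liftDom (idᶠ 𝔸) ⨾ f ≃ liftDom f
  liftDom-id-⨾ = begin
    liftDom (idᶠ 𝔸) ⨾ f  ≈⟨ liftDom-⨾ (idᶠ 𝔸) f ⟩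
    liftDom (idᶠ 𝔸 ⨾ f)  ≈⟨ liftDom-cong (⨾-identityˡ ap) ⟩
    liftDom f             ∎

module _ {𝔸 𝔹 : CIF} {g : S 𝔸 ⇸ 𝔹} (ap : IsApprox (S 𝔸) 𝔹 (rel g)) where
  open IsApprox ap

  liftDom-restrict : liftDom (liftCod (idᶠ 𝔸) ⨾ g) ≃ g
  liftDom-restrict = from-≈F λ p Y c →
    (λ (cY , _ , _ , _ , p⊳qV , gc) → cut ap cY (All.map (cY ,_) p⊳qV) gc) ,
    λ gc → let q , U , cU , Y⊨qU , gU = interpolate-dom ap (H⇒Con gc) (gc ∷ [])
           in H⇒Con gc , q , U , cU , All.map proj₂ Y⊨qU , All.head gU

⟦_⟧ : ∀ {a b} → Hom a b → frame a ⇸ frame b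
⟦ φ ⟧ = wrap (Hom.fam φ)

Sᵗ : CIFt → CIFt
Sᵗ a = record
  { frame = S (frame a)
  ; t     = pair (CIFt.t a) [] (Con-[] (frame a) (CIFt.t a))
  ; truth = S-truth (frame a) (CIFt.truth a)
  }

idHom : ∀ a → Hom a a
idHom a = record
  { fam    = rel (idᶠ (frame a))
  ; approx = id-approx (frame a)
  ; resp   = CIFt.truth a (CIFt.t a)
  }

liftCodHom : ∀ {a b} → Hom a b → Hom a (Sᵗ b)
liftCodHom φ = record
  { fam    = rel (liftCod ⟦ φ ⟧)
  ; approx = liftCod-approx (Hom.approx φ)
  ; resp   = Hom.resp φ ∷ []
  }

liftDomHom : ∀ {a b} → Hom a b → Hom (Sᵗ a) b
liftDomHom φ = record
  { fam    = rel (liftDom ⟦ φ ⟧)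
  ; approx = liftDom-approx (Hom.approx φ)
  ; resp   = inj₂ [] , Hom.resp φ
  }

toS : ∀ a → Hom a (Sᵗ a)
toS a = liftCodHom (idHom a)

fromS : ∀ a → Hom (Sᵗ a) a
fromS a = liftDomHom (idHom a)

S₁ : ∀ {a b} → Hom a b → Hom (Sᵗ a) (Sᵗ b)
S₁ φ = liftDomHom (liftCodHom φ)

module _ (a : CIFt) where
  private A = frame a
  open ≃-Reasoning

  toS-fromS : ⟦ toS a ⟧ ⨾ ⟦ fromS a ⟧ ≃ idᶠ A
  toS-fromS = liftCod-id-⨾-liftDom (id-approx A)

  fromS-toS : ⟦ fromS a ⟧ ⨾ ⟦ toS a ⟧ ≃ idᶠ (S A)
  fromS-toS = begin
    liftDom (idᶠ A) ⨾ liftCod (idᶠ A)  ≈⟨ liftDom-id-⨾ (liftCod-approx (id-approx A)) ⟩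
    liftDom (liftCod (idᶠ A))          ≡⟨⟩
    idᶠ (S A)                          ∎

module _ {a b : CIFt} (φ : Hom a b) where
  private
    A = frame a
    B = frame b
    ap = Hom.approx φ
  open ≃-Reasoning

  toS-natural : ⟦ φ ⟧ ⨾ ⟦ toS b ⟧ ≃ ⟦ toS a ⟧ ⨾ ⟦ S₁ φ ⟧
  toS-natural = begin
    ⟦ φ ⟧ ⨾ liftCod (idᶠ B)                  ≈⟨ ⨾-liftCod ap (id-approx B) ⟩
    liftCod (⟦ φ ⟧ ⨾ idᶠ B)                  ≈⟨ liftCod-cong (⨾-identityʳ ap) ⟩
    liftCod ⟦ φ ⟧                            ≈⟨ liftCod-id-⨾-liftDom (liftCod-approx ap) ⟨
    liftCod (idᶠ A) ⨾ liftDom (liftCod ⟦ φ ⟧)  ∎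

  fromS-natural : ⟦ S₁ φ ⟧ ⨾ ⟦ fromS b ⟧ ≃ ⟦ fromS a ⟧ ⨾ ⟦ φ ⟧
  fromS-natural = begin
    liftDom (liftCod ⟦ φ ⟧) ⨾ liftDom (idᶠ B)
      ≈⟨ liftDom-⨾ (liftCod ⟦ φ ⟧) (liftDom (idᶠ B)) ⟩
    liftDom (liftCod ⟦ φ ⟧ ⨾ liftDom (idᶠ B))
      ≈⟨ liftDom-cong (liftCod-⨾-liftDom _ _) ⟩
    liftDom (⟦ φ ⟧ ⨾ idᶠ B)
      ≈⟨ liftDom-cong (⨾-identityʳ ap) ⟩
    liftDom ⟦ φ ⟧
      ≈⟨ liftDom-id-⨾ ap ⟨
    liftDom (idᶠ A) ⨾ ⟦ φ ⟧
      ∎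

  toS-⨾-liftDomHom : ⟦ toS a ⟧ ⨾ ⟦ liftDomHom φ ⟧ ≃ ⟦ φ ⟧
  toS-⨾-liftDomHom = liftCod-id-⨾-liftDom ap

  liftDomHom-unique : (ψ : Hom (Sᵗ a) b) → ⟦ toS a ⟧ ⨾ ⟦ ψ ⟧ ≃ ⟦ φ ⟧ → ⟦ ψ ⟧ ≃ ⟦ liftDomHom φ ⟧
  liftDomHom-unique ψ toS⨾ψ≃φ = begin
    ⟦ ψ ⟧                              ≈⟨ liftDom-restrict (Hom.approx ψ) ⟨
    liftDom (liftCod (idᶠ A) ⨾ ⟦ ψ ⟧)  ≈⟨ liftDom-cong toS⨾ψ≃φ ⟩
    liftDom ⟦ φ ⟧                      ∎

S₁-cong : ∀ {a b} (φ ψ : Hom a b) → ⟦ φ ⟧ ≃ ⟦ ψ ⟧ → ⟦ S₁ φ ⟧ ≃ ⟦ S₁ ψ ⟧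
S₁-cong _ _ = liftDom-cong ∘ liftCod-cong

S₁-id : ∀ {a} (κ : Hom a a) → ⟦ κ ⟧ ≃ idᶠ (frame a) → ⟦ S₁ κ ⟧ ≃ idᶠ (S (frame a))
S₁-id {a} κ = S₁-cong κ (idHom a)

S₁-⨾ : ∀ {a b c} (φ : Hom a b) (ψ : Hom b c) (χ : Hom a c) →
  ⟦ χ ⟧ ≃ ⟦ φ ⟧ ⨾ ⟦ ψ ⟧ → ⟦ S₁ χ ⟧ ≃ ⟦ S₁ φ ⟧ ⨾ ⟦ S₁ ψ ⟧
S₁-⨾ φ ψ χ χ≃φ⨾ψ = begin
  liftDom (liftCod ⟦ χ ⟧)
    ≈⟨ liftDom-cong (liftCod-cong χ≃φ⨾ψ) ⟩
  liftDom (liftCod (⟦ φ ⟧ ⨾ ⟦ ψ ⟧))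
    ≈⟨ liftDom-cong (⨾-liftCod (Hom.approx φ) (Hom.approx ψ)) ⟨
  liftDom (⟦ φ ⟧ ⨾ liftCod ⟦ ψ ⟧)
    ≈⟨ liftDom-cong (liftCod-⨾-liftDom _ _) ⟨
  liftDom (liftCod ⟦ φ ⟧ ⨾ liftDom (liftCod ⟦ ψ ⟧))
    ≈⟨ liftDom-⨾ (liftCod ⟦ φ ⟧) (liftDom (liftCod ⟦ ψ ⟧)) ⟨
  liftDom (liftCod ⟦ φ ⟧) ⨾ liftDom (liftCod ⟦ ψ ⟧)
    ∎
  where open ≃-Reasoning

S-functor : Functor CIFtCat SIFtCat
S-functor = record
  { F₀     = λ a → Sᵗ a , S-strong (frame a)
  ; F₁     = S₁
  ; F-resp = λ φ ψ → to-≈F ∘ S₁-cong φ ψ ∘ from-≈F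
  ; F-id   = λ κ → to-≈F ∘ S₁-id κ ∘ from-≈F
  ; F-comp = λ φ ψ χ → to-≈F ∘ S₁-⨾ φ ψ χ ∘ from-≈F
  }

inclusion : Functor SIFtCat CIFtCat
inclusion = record
  { F₀     = proj₁
  ; F₁     = id
  ; F-resp = λ _ _ → id
  ; F-id   = λ _ → id
  ; F-comp = λ _ _ _ → id
  }

theorem5p10 : IsReflective CIFtCat (λ 𝔸 → IsStrong (CIFt.frame 𝔸)) × Equivalence SIFtCat CIFtCat
theorem5p10 = reflective , equivalence
  where
  -- The strongness of the target is unused: toS a is an isomorphism.
  reflective : IsReflective CIFtCat (λ 𝔸 → IsStrong (CIFt.frame 𝔸))
  reflective a = Sᵗ a , S-strong (frame a) , toS a , λ _ _ φ →
    liftDomHom φ , to-≈F (toS-⨾-liftDomHom φ) ,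
    λ ψ toS⨾ψ≈φ → to-≈F (liftDomHom-unique φ ψ (from-≈F toS⨾ψ≈φ))

  equivalence : Equivalence SIFtCat CIFtCat
  equivalence = record
    { F      = inclusion
    ; G      = S-functor
    ; η      = toS ∘ proj₁
    ; η⁻¹    = fromS ∘ proj₁
    ; η-iso₁ = to-≈F ∘ toS-fromS ∘ proj₁
    ; η-iso₂ = to-≈F ∘ fromS-toS ∘ proj₁
    ; η-nat  = to-≈F ∘ toS-natural
    ; ε      = fromS
    ; ε⁻¹    = toS
    ; ε-iso₁ = to-≈F ∘ fromS-toS
    ; ε-iso₂ = to-≈F ∘ toS-fromS
    ; ε-nat  = to-≈F ∘ fromS-natural
    }
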